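{- Let $\pi\in\mathrm{DWD}_m$ and $(S,T)\in\mathcal{C}_m$, and let $\chi_{S,T}:\mathcal{C}_m\to\mathbb{Z}/2\mathbb{Z}$ send $(S,T)$ to $1$ and every other complementary pair to $0$. Then: (1) $Fl_{S,T}(\pi)\in\mathrm{DWD}_m$; (2) $\varphi(Fl_{S,T}(\pi))=\varphi(\pi)+\chi_{S,T}$; (3) $\ell(Fl_{S,T}(\pi))=\ell(\pi)+1$ if $\varphi(\pi)(S,T)=0$, and $\ell(Fl_{S,T}(\pi))=\ell(\pi)-1$ if $\varphi(\pi)(S,T)=1$.
   Context: Let $[n]=\{0,\dots,n-1\}$, $S_n$ the bijections of $[n]$, $m\ge1$. A basic $k$-interval ($0\le k\le m$) is $\{c2^k,\dots,(c+1)2^k-1\}\subseteq[2^m]$. $\pi\in S_{2^m}$ is dyadically well-distributed if for every basic $k_1$-interval $S$ and basic $k_2$-interval $T$ with $k_1+k_2=m$ there is exactly one $i\in S$ with $\pi(i)\in T$; $\mathrm{DWD}_m$ is the set of these. $\ell(\pi)$ is the number of inversions. A complementary pair is $(S,T)$ with $S$ a basic $k_1$-interval, $T$ a basic $k_2$-interval, $k_1+k_2=m+1$, $k_1,k_2\ge1$; $\mathcal{C}_m$ is the set of these. For $\pi\in\mathrm{DWD}_m$ and $(S,T)\in\mathcal{C}_m$ there are exactly two $a<b$ in $S$ with $\pi(a),\pi(b)\in T$; $\varphi(\pi)(S,T)=0$ if $\pi(a)<\pi(b)$ and $1$ if $\pi(a)>\pi(b)$ (so $\varphi(\pi)$ is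 a function $\mathcal{C}_m\to\mathbb{Z}/2\mathbb{Z}$, addition being pointwise). The flip $Fl_{S,T}(\pi)$ is $\pi\circ(a\ b)$, i.e. the permutation agreeing with $\pi$ except that it sends $a$ to $\pi(b)$ and $b$ to $\pi(a)$. -}

module Defs where

open import Data.Nat using (ℕ; zero; suc; _+_; _*_; _∸_; _^_; _≤_; _<_; _≤ᵇ_; _<ᵇ_; _≡ᵇ_)
open import Data.Bool using (Bool; true; false; _∧_; _xor_)
open import Data.Fin using (Fin; toℕ)
open import Data.Fin.Permutation using (Permutation′; _⟨$⟩ʳ_; _∘ₚ_; transpose)
open import Data.List using (List; []; _∷_; allFin; filterᵇ; length; concatMap; map)
open import Data.Product using (Σ; _×_; _,_; ∃!; proj₁; proj₂)
open import Relation.Binary.PropositionalEquality using (_≡_)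

Perm : ℕ → Set
Perm n = Permutation′ n

-- A basic k-interval of [2^m]: {c·2^k, …, (c+1)·2^k − 1}, with 0 ≤ c < 2^(m−k).
-- (k ≤ m is imposed where basic intervals are used.)
record BasicInterval (m k : ℕ) : Set where
  constructor interval
  field
    c     : ℕ
    c<    : c < 2 ^ (m ∸ k)
open BasicInterval public

inIntervalᵇ : ∀ {m} (k c : ℕ) → Fin (2 ^ m) → Bool
inIntervalᵇ k c i = (c * 2 ^ k ≤ᵇ toℕ i) ∧ (toℕ i <ᵇ suc c * 2 ^ k)

_∈I_ : ∀ {m k} → Fin (2 ^ m) → BasicInterval m k → Set
_∈I_ {m} {k} i S = c S * 2 ^ k ≤ toℕ i × toℕ i < suc (c S) * 2 ^ k

DWD : (m : ℕ) → Perm (2 ^ m) → Set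
DWD m π = (k₁ k₂ : ℕ) → k₁ + k₂ ≡ m →
  (S : BasicInterval m k₁) (T : BasicInterval m k₂) →
  ∃! _≡_ (λ (i : Fin (2 ^ m)) → (i ∈I S) × ((π ⟨$⟩ʳ i) ∈I T))

record CPair (m : ℕ) : Set where
  constructor cpair
  field
    k₁ k₂  : ℕ
    sum≡   : k₁ + k₂ ≡ suc m
    1≤k₁   : 1 ≤ k₁
    1≤k₂   : 1 ≤ k₂
    S      : BasicInterval m k₁
    T      : BasicInterval m k₂
open CPair public

hits : ∀ {m} → Perm (2 ^ m) → CPair m → List (Fin (2 ^ m))
hits {m} π P =
  filterᵇ (λ i → inIntervalᵇ {m} (k₁ P) (c (S P)) i
               ∧ inIntervalᵇ {m} (k₂ P) (c (T P)) (π ⟨$⟩ʳ i))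
          (allFin (2 ^ m))

-- φ(π)(S,T) ∈ ℤ/2ℤ, represented by Bool (false = 0, true = 1, xor = addition).
-- For π ∈ DWD_m the list `hits` has exactly two elements a < b.
φ : ∀ {m} → Perm (2 ^ m) → CPair m → Bool
φ π P with hits π P
... | a ∷ b ∷ _ = toℕ (π ⟨$⟩ʳ b) <ᵇ toℕ (π ⟨$⟩ʳ a)
... | _ = false

Fl : ∀ {m} → CPair m → Perm (2 ^ m) → Perm (2 ^ m)
Fl P π with hits π P
... | a ∷ b ∷ _ = transpose a b ∘ₚ π
... | _ = π

-- χ_{S,T}: 1 at (S,T), 0 at every other complementary pair.
-- Two complementary pairs are equal iff their interval data (k₁,c₁,k₂,c₂) agree.
χ : ∀ {m} → CPair m → CPair m → Bool
χ P Q = (k₁ P ≡ᵇ k₁ Q) ∧ (c (S P) ≡ᵇ c (S Q)) ∧ (k₂ P ≡ᵇ k₂ Q) ∧ (c (T P) ≡ᵇ c (T Q))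

ℓ : ∀ {n} → Perm n → ℕ
ℓ {n} π = length (filterᵇ (λ ij → inv (proj₁ ij) (proj₂ ij))
                          (concatMap (λ i → map (λ j → i , j) (allFin n)) (allFin n)))
  where
  inv : Fin n → Fin n → Bool
  inv i j = (toℕ i <ᵇ toℕ j) ∧ (toℕ (π ⟨$⟩ʳ j) <ᵇ toℕ (π ⟨$⟩ʳ i))

module Submission where

-- Let a < b be the two points of S that π maps into T. By well-distribution they lie in different
-- halves of S, π a and π b lie in different halves of T, and no other point of S is mapped into T.
-- Hence for every dyadic box S′ × T′ of total level at least m, S′ does not separate a from b or
-- T′ does not separate π a from π b. The flip therefore moves the points of π in S′ × T′ onto those
-- of Fl(π), by the transposition (a b) or by the identity; this gives (1), and for a complementary
-- box it changes the relative order of its two points only when these are a and b, i.e. for (S, T),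
-- which gives (2). For (3), every point strictly between a and b lies in S, so its value lies outside
-- T and thus not between π a and π b, so transposing a and b changes ℓ by exactly one.

open import Defs
open import Data.Bool using (Bool; true; false; _∧_; _xor_; not)
import Data.Bool as Bool
open import Data.Bool.Properties
  using (T?; T-∧; T-≡; not-distribʳ-xor; xor-comm; true-xor; xor-identityʳ)
open import Data.Empty using (⊥-elim)
open import Data.Fin using (Fin; zero; suc; toℕ; punchIn) renaming (_≟_ to _≟ᶠ_)
open import Data.Fin.Permutation using (_⟨$⟩ʳ_; _∘ₚ_; transpose)
import Data.Fin.Permutation.Components as PC
open import Data.Fin.Properties using (punchInᵢ≢i; toℕ-injective; toℕ<n)
open import Data.List using (List; _∷_; []; _++_; length; filterᵇ; tabulate; concatMap; map; allFin)
open import Data.List.Membership.Propositional using (_∈_)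
open import Data.List.Membership.Propositional.Properties using (∈-filter⁺; ∈-filter⁻; ∈-allFin)
open import Data.List.Properties using (filter-++; length-++; map-tabulate)
open import Data.List.Relation.Unary.All as All using (All)
open import Data.List.Relation.Unary.AllPairs using (AllPairs; []; _∷_)
open import Data.List.Relation.Unary.AllPairs.Properties using (filter⁺; tabulate⁺-<)
open import Data.List.Relation.Unary.Any using (here; there)
open import Data.Nat
open import Data.Nat.DivMod
open import Data.Nat.Properties
open import Data.Product using (∃-syntax; ∃!; _×_; _,_; proj₁; proj₂)
open import Data.Product.Function.NonDependent.Propositional using (_×-⇔_)
open import Data.Sum as Sum using (_⊎_; inj₁; inj₂; [_,_]′)
open import Data.Sum.Function.Propositional using (_⊎-⇔_)
open import Data.Vec.Functional using (removeAt)
open import Function using (_∘_; id)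
open import Function.Bundles using (_⇔_; mk⇔; Equivalence; Injection)
open import Function.Construct.Composition using (_⇔-∘_)
open import Function.Construct.Identity using (⇔-id)
open import Function.Construct.Symmetry using (⇔-sym)
open import Function.Properties.Inverse using (↔⇒↣)
open import Relation.Binary.Definitions using (tri<; tri≈; tri>)
open import Relation.Binary.PropositionalEquality
open import Relation.Nullary using (¬_; yes; no; contradiction)
open import Relation.Nullary.Decidable using (dec-true; dec-false)
open import Relation.Nullary.Reflects using (det; fromEquivalence; ofʸ; ofⁿ)
open import Algebra.Properties.CommutativeMonoid.Sum +-0-commutativeMonoid
  using (sum; sum-remove; sum-cong-≗; ∑-distrib-+)
open import Algebra.Properties.CommutativeSemigroup +-commutativeSemigroup using (xy∙z≈xz∙y; xy∙z≈zy∙x)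

≡-resp : ∀ {A : Set} {x y c : A} → x ≡ y → (x ≡ c ⇔ y ≡ c)
≡-resp x≡y = mk⇔ (trans (sym x≡y)) (trans x≡y)

∃!-transport : ∀ {A : Set} {P Q : A → Set} (f : A → A) → (∀ x → f (f x) ≡ x) →
  (∀ x → Q x ⇔ P (f x)) → ∃! _≡_ P → ∃! _≡_ Q
∃!-transport {P = P} f f-involutive Q⇔P∘f (x , Px , unique) =
  f x , Equivalence.from (Q⇔P∘f (f x)) (subst P (sym (f-involutive x)) Px) ,
  λ {y} Qy → trans (cong f (unique (Equivalence.to (Q⇔P∘f y) Qy))) (f-involutive y)

+-complement-≤ : ∀ {a b x y} → a + b ≤ x + y → x ≤ a → b ≤ y
+-complement-≤ {a} {b} {x} {y} a+b≤x+y x≤a = +-cancelˡ-≤ a b y (≤-trans a+b≤x+y (+-monoˡ-≤ y x≤a))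

-- Dyadic blocks

block : ℕ → ℕ → ℕ
block k x = _/_ x (2 ^ k) {{m^n≢0 2 k}}

module _ (k : ℕ) where

  private instance
    2^k≢0 : NonZero (2 ^ k)
    2^k≢0 = m^n≢0 2 k

  block≡⇔ : ∀ {x c} → block k x ≡ c ⇔ (c * 2 ^ k ≤ x × x < suc c * 2 ^ k)
  block≡⇔ {x} = mk⇔ bounds (λ (lo , hi) → exact lo hi)
    where
    bounds : ∀ {c} → block k x ≡ c → c * 2 ^ k ≤ x × x < suc c * 2 ^ k
    bounds refl = m/n*n≤m x (2 ^ k) , (begin-strict
      x                               ≡⟨ m≡m%n+[m/n]*n x (2 ^ k) ⟩
      x % 2 ^ k + x / 2 ^ k * 2 ^ k   <⟨ +-monoˡ-< (x / 2 ^ k * 2 ^ k) (m%n<n x (2 ^ k)) ⟩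
      2 ^ k + x / 2 ^ k * 2 ^ k       ∎)
      where open ≤-Reasoning
    exact : ∀ {c} → c * 2 ^ k ≤ x → x < suc c * 2 ^ k → block k x ≡ c
    exact {c} lo hi = ≤-antisym (<⇒≤pred (m<n*o⇒m/o<n hi))
      (subst (_≤ block k x) (m*n/n≡m c (2 ^ k)) (/-monoˡ-≤ (2 ^ k) lo))

  block-mono-≤ : ∀ {x y} → x ≤ y → block k x ≤ block k y
  block-mono-≤ x≤y = /-monoˡ-≤ (2 ^ k) x≤y

  block-cancel-< : ∀ {x y} → block k x < block k y → x < y
  block-cancel-< lt = ≰⇒> (λ y≤x → <⇒≱ lt (block-mono-≤ y≤x))

block-+ : ∀ k e x → block (k + e) x ≡ block e (block k x)
block-+ k e x = begin
  x / 2 ^ (k + e)         ≡⟨ /-congʳ (^-distribˡ-+-* 2 k e) ⟩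
  x / (2 ^ k * 2 ^ e)     ≡⟨ m/n/o≡m/[n*o] x (2 ^ k) (2 ^ e) ⟨
  x / 2 ^ k / 2 ^ e       ∎
  where
  open ≡-Reasoning
  instance
    2^k≢0 : NonZero (2 ^ k)
    2^k≢0 = m^n≢0 2 k
    2^e≢0 : NonZero (2 ^ e)
    2^e≢0 = m^n≢0 2 e
    2^[k+e]≢0 : NonZero (2 ^ (k + e))
    2^[k+e]≢0 = m^n≢0 2 (k + e)
    2^k*2^e≢0 : NonZero (2 ^ k * 2 ^ e)
    2^k*2^e≢0 = m*n≢0 (2 ^ k) (2 ^ e)

block-coarsen : ∀ {k k′ x y} → k ≤ k′ → block k x ≡ block k y → block k′ x ≡ block k′ y
block-coarsen {k} {k′} {x} {y} k≤k′ eq = subst (λ n → block n x ≡ block n y) (m+[n∸m]≡n k≤k′)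
  (trans (block-+ k (k′ ∸ k) x) (trans (cong (block (k′ ∸ k)) eq) (sym (block-+ k (k′ ∸ k) y))))

halve≡⇔ : ∀ {n c} → n / 2 ≡ c ⇔ (n ≡ c * 2 ⊎ n ≡ suc (c * 2))
halve≡⇔ {n} = mk⇔ split join
  where
  split : ∀ {c} → n / 2 ≡ c → n ≡ c * 2 ⊎ n ≡ suc (c * 2)
  split refl with n % 2 | m%n<n n 2 | m≡m%n+[m/n]*n n 2
  ... | 0 | _ | n≡ = inj₁ n≡
  ... | 1 | _ | n≡ = inj₂ n≡
  ... | suc (suc _) | s≤s (s≤s ()) | _
  join : ∀ {c} → n ≡ c * 2 ⊎ n ≡ suc (c * 2) → n / 2 ≡ c
  join {c} (inj₁ refl) = m*n/n≡m c 2
  join {c} (inj₂ refl) = Equivalence.from (block≡⇔ 1) (n≤1+n _ , ≤-refl)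

block-suc≡⇔ : ∀ k {x c} → block (suc k) x ≡ c ⇔ (block k x ≡ c * 2 ⊎ block k x ≡ suc (c * 2))
block-suc≡⇔ k {x} {c} =
  subst (λ n → n ≡ c ⇔ (block k x ≡ c * 2 ⊎ block k x ≡ suc (c * 2))) (sym block-suc) halve≡⇔
  where
  block-suc : block (suc k) x ≡ block k x / 2
  block-suc = subst (λ n → block n x ≡ block k x / 2) (+-comm k 1) (block-+ k 1 x)

block-< : ∀ {m k x} → k ≤ m → x < 2 ^ m → block k x < 2 ^ (m ∸ k)
block-< {m} {k} {x} k≤m x<2^m = m<n*o⇒m/o<n {{m^n≢0 2 k}} (subst (x <_) 2^m≡ x<2^m)
  where
  2^m≡ : 2 ^ m ≡ 2 ^ (m ∸ k) * 2 ^ k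
  2^m≡ = trans (cong (2 ^_) (sym (m∸n+n≡m k≤m))) (^-distribˡ-+-* 2 (m ∸ k) k)

children-< : ∀ {m k c} → k < m → c < 2 ^ (m ∸ suc k) → suc (c * 2) < 2 ^ (m ∸ k)
children-< {m} {k} {c} k<m c< = subst (suc (c * 2) <_) (sym 2^[m∸k]) (*-monoˡ-≤ 2 c<)
  where
  2^[m∸k] : 2 ^ (m ∸ k) ≡ 2 ^ (m ∸ suc k) * 2
  2^[m∸k] = trans (cong (2 ^_) (+-∸-assoc 1 k<m)) (*-comm 2 (2 ^ (m ∸ suc k)))

<ᵇ-true : ∀ {x y} → x < y → (x <ᵇ y) ≡ true
<ᵇ-true {x} {y} x<y = det (<ᵇ-reflects-< x y) (ofʸ x<y)

<ᵇ-false : ∀ {x y} → ¬ x < y → (x <ᵇ y) ≡ false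
<ᵇ-false {x} {y} x≮y = det (<ᵇ-reflects-< x y) (ofⁿ x≮y)

<ᵇ-cong : ∀ {x y u w} → (x < y ⇔ u < w) → (x <ᵇ y) ≡ (u <ᵇ w)
<ᵇ-cong {x} {y} {u} {w} x<y⇔u<w = det (<ᵇ-reflects-< x y)
  (fromEquivalence (λ t → Equivalence.from x<y⇔u<w (<ᵇ⇒< u w t)) (λ x<y → <⇒<ᵇ (Equivalence.to x<y⇔u<w x<y)))

<ᵇ-flip : ∀ {x y} → x ≢ y → (y <ᵇ x) ≡ not (x <ᵇ y)
<ᵇ-flip {x} {y} x≢y with <-cmp x y
... | tri< x<y _ _ = trans (<ᵇ-false (<⇒≯ x<y)) (cong not (sym (<ᵇ-true x<y)))
... | tri≈ _ x≡y _ = contradiction x≡y x≢y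
... | tri> _ _ y<x = trans (<ᵇ-true y<x) (cong not (sym (<ᵇ-false (<⇒≯ y<x))))

SameSide : ℕ → ℕ → ℕ → Set
SameSide u w t = ((t <ᵇ u) ≡ (t <ᵇ w)) × ((u <ᵇ t) ≡ (w <ᵇ t))

block-sameSide : ∀ k {c u w t} → block k u ≡ c → block k w ≡ c → block k t ≢ c → SameSide u w t
block-sameSide k {c} {u} {w} {t} u∈ w∈ t∉ =
  <ᵇ-cong (mk⇔ (below u∈ w∈) (below w∈ u∈)) , <ᵇ-cong (mk⇔ (above u∈ w∈) (above w∈ u∈))
  where
  below : ∀ {u w} → block k u ≡ c → block k w ≡ c → t < u → t < w
  below u∈ w∈ t<u = block-cancel-< k (subst (block k t <_) (sym w∈)
    (≤∧≢⇒< (subst (block k t ≤_) u∈ (block-mono-≤ k (<⇒≤ t<u))) t∉))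
  above : ∀ {u w} → block k u ≡ c → block k w ≡ c → u < t → w < t
  above u∈ w∈ u<t = block-cancel-< k (subst (_< block k t) (sym w∈)
    (≤∧≢⇒< (subst (_≤ block k t) u∈ (block-mono-≤ k (<⇒≤ u<t))) (≢-sym t∉)))

-- Sums and inversions

iverson : Bool → ℕ
iverson true  = 1
iverson false = 0

∑-update : ∀ {n} (f g : Fin n → ℕ) (a : Fin n) → (∀ j → j ≢ a → f j ≡ g j) →
  sum f + g a ≡ sum g + f a
∑-update {suc n} f g a f≗g = begin
  sum f + g a                          ≡⟨ cong (_+ g a) (sum-remove {i = a} f) ⟩
  f a + sum (removeAt f a) + g a       ≡⟨ cong (λ s → f a + s + g a) (sum-cong-≗ off-a) ⟩
  f a + sum (removeAt g a) + g a       ≡⟨ xy∙z≈zy∙x (f a) _ (g a) ⟩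
  g a + sum (removeAt g a) + f a       ≡⟨ cong (_+ f a) (sum-remove {i = a} g) ⟨
  sum g + f a                          ∎
  where
  open ≡-Reasoning
  off-a : removeAt f a ≗ removeAt g a
  off-a j = f≗g (punchIn a j) (punchInᵢ≢i a j)

∑-update₂ : ∀ {n} (f g : Fin n → ℕ) {a b : Fin n} → a ≢ b → (∀ j → j ≢ a → j ≢ b → f j ≡ g j) →
  sum f + (g a + g b) ≡ sum g + (f a + f b)
∑-update₂ {n} f g {a} {b} a≢b f≗g = begin
  sum f + (g a + g b)      ≡⟨ sym (+-assoc (sum f) (g a) (g b)) ⟩
  sum f + g a + g b        ≡⟨ cong (λ x → sum f + x + g b) (sym h-a) ⟩
  sum f + h a + g b        ≡⟨ cong (_+ g b) (∑-update f h a (λ j j≢a → sym (h≡f j j≢a))) ⟩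
  sum h + f a + g b        ≡⟨ xy∙z≈xz∙y (sum h) (f a) (g b) ⟩
  sum h + g b + f a        ≡⟨ cong (_+ f a) (∑-update h g b h≡g) ⟩
  sum g + h b + f a        ≡⟨ cong (λ x → sum g + x + f a) (h≡f b (≢-sym a≢b)) ⟩
  sum g + f b + f a        ≡⟨ xy∙z≈xz∙y (sum g) (f b) (f a) ⟩
  sum g + f a + f b        ≡⟨ +-assoc (sum g) (f a) (f b) ⟩
  sum g + (f a + f b)      ∎
  where
  open ≡-Reasoning
  h : Fin n → ℕ
  h j with j ≟ᶠ a
  ... | yes _ = g j
  ... | no  _ = f j
  h≡f : ∀ j → j ≢ a → h j ≡ f j
  h≡f j j≢a with j ≟ᶠ a
  ... | yes j≡a = contradiction j≡a j≢a
  ... | no  _   = refl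
  h-a : h a ≡ g a
  h-a with a ≟ᶠ a
  ... | yes _   = refl
  ... | no  a≢a = contradiction refl a≢a
  h≡g : ∀ j → j ≢ b → h j ≡ g j
  h≡g j j≢b with j ≟ᶠ a
  ... | yes _   = refl
  ... | no  j≢a = f≗g j j≢a j≢b

iverson-∧-exchange : ∀ x y v w → x ≡ y ⊎ v ≡ w →
  iverson (x ∧ w) + iverson (y ∧ v) ≡ iverson (x ∧ v) + iverson (y ∧ w)
iverson-∧-exchange x .x v w (inj₁ refl) = +-comm (iverson (x ∧ w)) (iverson (x ∧ v))
iverson-∧-exchange x y  v .v (inj₂ refl) = refl

inverted : ∀ {n} → (Fin n → ℕ) → Fin n → Fin n → Bool
inverted f i j = (toℕ i <ᵇ toℕ j) ∧ (f j <ᵇ f i)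

inversions : ∀ {n} → (Fin n → ℕ) → ℕ
inversions f = sum (λ i → sum (λ j → iverson (inverted f i j)))

-- Transpositions

module Transposition {n} {a b : Fin n} (a<b : toℕ a < toℕ b) where

  a≢b : a ≢ b
  a≢b a≡b = <-irrefl (cong toℕ a≡b) a<b

  swap : Fin n → Fin n
  swap = PC.transpose a b

  swap-a : swap a ≡ b
  swap-a rewrite dec-true (a ≟ᶠ a) refl = refl

  swap-b : swap b ≡ a
  swap-b rewrite dec-false (b ≟ᶠ a) (≢-sym a≢b) | dec-true (b ≟ᶠ b) refl = refl

  swap-other : ∀ {j} → j ≢ a → j ≢ b → swap j ≡ j
  swap-other {j} j≢a j≢b rewrite dec-false (j ≟ᶠ a) j≢a | dec-false (j ≟ᶠ b) j≢b = refl

  data View : Fin n → Set where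
    at-a      : View a
    at-b      : View b
    elsewhere : ∀ {j} → j ≢ a → j ≢ b → View j

  view : ∀ j → View j
  view j with j ≟ᶠ a | j ≟ᶠ b
  ... | yes refl | _        = at-a
  ... | no _     | yes refl = at-b
  ... | no j≢a   | no j≢b   = elsewhere j≢a j≢b

  swap-involutive : ∀ j → swap (swap j) ≡ j
  swap-involutive j with view j
  ... | at-a = trans (cong swap swap-a) swap-b
  ... | at-b = trans (cong swap swap-b) swap-a
  ... | elsewhere j≢a j≢b = trans (cong swap (swap-other j≢a j≢b)) (swap-other j≢a j≢b)

  Moved : Fin n → Set
  Moved j = j ≡ a ⊎ j ≡ b

  swap-moved : ∀ {g} → Moved g → Moved (swap g)
  swap-moved (inj₁ refl) = inj₂ swap-a
  swap-moved (inj₂ refl) = inj₁ swap-b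

  moved-joined : (h : Fin n → ℕ) → ∀ {g c} → Moved g → h g ≡ c → h (swap g) ≡ c → h a ≡ h b
  moved-joined h (inj₁ refl) ha hb = trans ha (sym (subst (λ i → h i ≡ _) swap-a hb))
  moved-joined h (inj₂ refl) hb ha = trans (subst (λ i → h i ≡ _) swap-b ha) (sym hb)

  moved-separated : (h : Fin n → ℕ) → ∀ {g c} → Moved g → h g ≡ c → h (swap g) ≢ c → h a ≢ h b
  moved-separated h (inj₁ refl) ha hb≢ ha≡hb = hb≢ (subst (λ i → h i ≡ _) (sym swap-a) (trans (sym ha≡hb) ha))
  moved-separated h (inj₂ refl) hb ha≢ ha≡hb = ha≢ (subst (λ i → h i ≡ _) (sym swap-b) (trans ha≡hb hb))

  swap-resp : (P : Fin n → Set) → (P a ⇔ P b) → ∀ j → P j ⇔ P (swap j)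
  swap-resp P Pa⇔Pb j with view j
  ... | at-a = subst (λ i → P a ⇔ P i) (sym swap-a) Pa⇔Pb
  ... | at-b = subst (λ i → P b ⇔ P i) (sym swap-b) (⇔-sym Pa⇔Pb)
  ... | elsewhere j≢a j≢b = subst (λ i → P j ⇔ P i) (sym (swap-other j≢a j≢b)) (⇔-id _)

  ≡swap⇔swap≡ : ∀ {j x} → j ≡ swap x ⇔ swap j ≡ x
  ≡swap⇔swap≡ {j} {x} = mk⇔ (λ { refl → swap-involutive x }) (λ { refl → sym (swap-involutive j) })

  swap-unmoved-<ᵇ : (f : Fin n → ℕ) → ∀ {x y} → x ≢ a → x ≢ b → y ≢ a → y ≢ b →
    (f (swap x) <ᵇ f (swap y)) ≡ (f x <ᵇ f y)
  swap-unmoved-<ᵇ f x≢a x≢b y≢a y≢b = cong₂ (λ u w → f u <ᵇ f w) (swap-other x≢a x≢b) (swap-other y≢a y≢b)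

  -- As x and y avoid the moved point e, at most one of them is moved; since the other one lies on
  -- the same side of f a and f b, their comparison survives the swap.
  swap-preserves-<ᵇ : (f : Fin n → ℕ) → ∀ {x y e} → Moved e → x ≢ e → y ≢ e →
    (∀ {z} → z ≡ x ⊎ z ≡ y → z ≢ a → z ≢ b → SameSide (f a) (f b) (f z)) →
    (f (swap x) <ᵇ f (swap y)) ≡ (f x <ᵇ f y)
  swap-preserves-<ᵇ f {x} {y} e-moved x≢e y≢e sameSide with view x | view y
  ... | elsewhere x≢a x≢b | elsewhere y≢a y≢b = swap-unmoved-<ᵇ f x≢a x≢b y≢a y≢b
  ... | elsewhere x≢a x≢b | at-a rewrite swap-other x≢a x≢b | swap-a = sym (proj₁ (sameSide (inj₁ refl) x≢a x≢b))
  ... | elsewhere x≢a x≢b | at-b rewrite swap-other x≢a x≢b | swap-b = proj₁ (sameSide (inj₁ refl) x≢a x≢b)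
  ... | at-a | elsewhere y≢a y≢b rewrite swap-other y≢a y≢b | swap-a = sym (proj₂ (sameSide (inj₂ refl) y≢a y≢b))
  ... | at-b | elsewhere y≢a y≢b rewrite swap-other y≢a y≢b | swap-b = proj₂ (sameSide (inj₂ refl) y≢a y≢b)
  ... | at-a | at-a rewrite swap-a | <ᵇ-false (<-irrefl {f a} refl) | <ᵇ-false (<-irrefl {f b} refl) = refl
  ... | at-b | at-b rewrite swap-b | <ᵇ-false (<-irrefl {f a} refl) | <ᵇ-false (<-irrefl {f b} refl) = refl
  ... | at-a | at-b = ⊥-elim ([ (λ e≡a → x≢e (sym e≡a)) , (λ e≡b → y≢e (sym e≡b)) ]′ e-moved)
  ... | at-b | at-a = ⊥-elim ([ (λ e≡a → y≢e (sym e≡a)) , (λ e≡b → x≢e (sym e≡b)) ]′ e-moved)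

  Between : ℕ → Set
  Between x = toℕ a < x × x < toℕ b

  left-of-both-or-between : ∀ x → x ≢ toℕ a → (x <ᵇ toℕ a) ≡ (x <ᵇ toℕ b) ⊎ Between x
  left-of-both-or-between x x≢a with x <? toℕ a | x <? toℕ b
  ... | yes x<a | _       = inj₁ (trans (<ᵇ-true x<a) (sym (<ᵇ-true (<-trans x<a a<b))))
  ... | no x≮a  | yes x<b = inj₂ (≤∧≢⇒< (≮⇒≥ x≮a) (≢-sym x≢a) , x<b)
  ... | no x≮a  | no x≮b  = inj₁ (trans (<ᵇ-false x≮a) (sym (<ᵇ-false x≮b)))

  right-of-both-or-between : ∀ x → x ≢ toℕ b → (toℕ a <ᵇ x) ≡ (toℕ b <ᵇ x) ⊎ Between x
  right-of-both-or-between x x≢b with toℕ b <? x | toℕ a <? x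
  ... | yes b<x | _       = inj₁ (trans (<ᵇ-true (<-trans a<b b<x)) (sym (<ᵇ-true b<x)))
  ... | no b≮x  | yes a<x = inj₂ (a<x , ≤∧≢⇒< (≮⇒≥ b≮x) x≢b)
  ... | no b≮x  | no a≮x  = inj₁ (trans (<ᵇ-false a≮x) (sym (<ᵇ-false b≮x)))

  module _ (f : Fin n → ℕ) (between⇒sameSide : ∀ z → Between (toℕ z) → SameSide (f a) (f b) (f z)) where

    private
      g : Fin n → ℕ
      g = f ∘ swap

      row : (Fin n → ℕ) → Fin n → ℕ
      row h i = sum (λ j → iverson (inverted h i j))

      column : (Fin n → ℕ) → Fin n → ℕ
      column h j = iverson (inverted h a j) + iverson (inverted h b j)

      rows-ab : ∀ h → sum (column h) ≡ row h a + row h b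
      rows-ab h = ∑-distrib-+ (λ j → iverson (inverted h a j)) (λ j → iverson (inverted h b j))

      row-other : ∀ i → i ≢ a → i ≢ b → row g i ≡ row f i
      row-other i i≢a i≢b = +-cancelʳ-≡ _ _ _ (begin
        row g i + (cell f a + cell f b)   ≡⟨ ∑-update₂ (cell g) (cell f) a≢b agree ⟩
        row f i + (cell g a + cell g b)   ≡⟨ cong (row f i +_) ends ⟩
        row f i + (cell f a + cell f b)   ∎)
        where
        open ≡-Reasoning
        cell : (Fin n → ℕ) → Fin n → ℕ
        cell h j = iverson (inverted h i j)
        agree : ∀ j → j ≢ a → j ≢ b → cell g j ≡ cell f j
        agree j j≢a j≢b = cong₂ (λ x y → iverson ((toℕ i <ᵇ toℕ j) ∧ (f x <ᵇ f y)))
          (swap-other j≢a j≢b) (swap-other i≢a i≢b)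
        ends : cell g a + cell g b ≡ cell f a + cell f b
        ends rewrite swap-a | swap-b | swap-other i≢a i≢b =
          iverson-∧-exchange (toℕ i <ᵇ toℕ a) (toℕ i <ᵇ toℕ b) (f a <ᵇ f i) (f b <ᵇ f i)
            (Sum.map₂ (λ btw → proj₂ (between⇒sameSide i btw))
              (left-of-both-or-between (toℕ i) (i≢a ∘ toℕ-injective)))

      column-other : ∀ j → j ≢ b → column g j ≡ column f j
      column-other j j≢b with view j
      ... | at-b = contradiction refl j≢b
      ... | at-a rewrite swap-a | swap-b | <ᵇ-false (<-irrefl {toℕ a} refl) | <ᵇ-false (<⇒≯ a<b) = refl
      ... | elsewhere j≢a _ rewrite swap-a | swap-b | swap-other j≢a j≢b =
        iverson-∧-exchange (toℕ a <ᵇ toℕ j) (toℕ b <ᵇ toℕ j) (f j <ᵇ f a) (f j <ᵇ f b)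
          (Sum.map₂ (λ btw → proj₁ (between⇒sameSide j btw))
            (right-of-both-or-between (toℕ j) (j≢b ∘ toℕ-injective)))

      column-b : ∀ h → column h b ≡ iverson (h b <ᵇ h a)
      column-b h rewrite <ᵇ-true a<b | <ᵇ-false (<-irrefl {toℕ b} refl) = +-identityʳ _

      rows : inversions g + sum (column f) ≡ inversions f + sum (column g)
      rows = begin
        inversions g + sum (column f)      ≡⟨ cong (inversions g +_) (rows-ab f) ⟩
        inversions g + (row f a + row f b) ≡⟨ ∑-update₂ (row g) (row f) a≢b row-other ⟩
        inversions f + (row g a + row g b) ≡⟨ cong (inversions f +_) (rows-ab g) ⟨
        inversions f + sum (column g)      ∎
        where open ≡-Reasoning

      columns : sum (column g) + column f b ≡ sum (column f) + column g b
      columns = ∑-update (column g) (column f) b column-other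

      balance : inversions g + column f b ≡ inversions f + column g b
      balance = +-cancelʳ-≡ (sum (column f)) _ _ (begin
        inversions g + column f b + sum (column f)    ≡⟨ xy∙z≈xz∙y (inversions g) _ _ ⟩
        inversions g + sum (column f) + column f b    ≡⟨ cong (_+ column f b) rows ⟩
        inversions f + sum (column g) + column f b    ≡⟨ +-assoc (inversions f) _ _ ⟩
        inversions f + (sum (column g) + column f b)  ≡⟨ cong (inversions f +_) columns ⟩
        inversions f + (sum (column f) + column g b)  ≡⟨ cong (inversions f +_) (+-comm _ (column g b)) ⟩
        inversions f + (column g b + sum (column f))  ≡⟨ +-assoc (inversions f) _ _ ⟨
        inversions f + column g b + sum (column f)    ∎)
        where open ≡-Reasoning

    inversions-swap : inversions (f ∘ swap) + iverson (f b <ᵇ f a) ≡ inversions f + iverson (f a <ᵇ f b)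
    inversions-swap = begin
      inversions g + iverson (f b <ᵇ f a)   ≡⟨ cong (inversions g +_) (column-b f) ⟨
      inversions g + column f b             ≡⟨ balance ⟩
      inversions f + column g b             ≡⟨ cong (inversions f +_) (column-b g) ⟩
      inversions f + iverson (g b <ᵇ g a)   ≡⟨ cong (λ t → inversions f + iverson t)
                                                     (cong₂ (λ x y → f x <ᵇ f y) swap-b swap-a) ⟩
      inversions f + iverson (f a <ᵇ f b)   ∎
      where open ≡-Reasoning

value : ∀ {n} → Perm n → Fin n → ℕ
value ρ j = toℕ (ρ ⟨$⟩ʳ j)

length-filterᵇ-tabulate : ∀ {A : Set} {n} (p : A → Bool) (f : Fin n → A) →
  length (filterᵇ p (tabulate f)) ≡ sum (λ i → iverson (p (f i)))
length-filterᵇ-tabulate {n = zero}  p f = refl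
length-filterᵇ-tabulate {n = suc n} p f with p (f zero)
... | true  = cong suc (length-filterᵇ-tabulate p (f ∘ suc))
... | false = length-filterᵇ-tabulate p (f ∘ suc)

length-filterᵇ-concatMap : ∀ {A B : Set} {n} (p : B → Bool) (g : A → List B) (h : Fin n → A) →
  length (filterᵇ p (concatMap g (tabulate h))) ≡ sum (λ i → length (filterᵇ p (g (h i))))
length-filterᵇ-concatMap {n = zero}  p g h = refl
length-filterᵇ-concatMap {B = B} {n = suc n} p g h = begin
  length (filterᵇ p (g (h zero) ++ rest))                  ≡⟨ cong length (filter-++ (T? ∘ p) (g (h zero)) rest) ⟩
  length (filterᵇ p (g (h zero)) ++ filterᵇ p rest)        ≡⟨ length-++ (filterᵇ p (g (h zero))) ⟩
  length (filterᵇ p (g (h zero))) + length (filterᵇ p rest) ≡⟨ cong (_ +_) (length-filterᵇ-concatMap p g (h ∘ suc)) ⟩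
  sum (λ i → length (filterᵇ p (g (h i))))                ∎
  where
  open ≡-Reasoning
  rest : List B
  rest = concatMap g (tabulate (h ∘ suc))

ℓ≡inversions : ∀ {n} (ρ : Perm n) → ℓ ρ ≡ inversions (value ρ)
ℓ≡inversions {n} ρ = trans (length-filterᵇ-concatMap p (λ i → map (λ j → i , j) (allFin n)) id)
  (sum-cong-≗ (λ i → trans (cong (length ∘ filterᵇ p) (map-tabulate id (λ j → i , j)))
                           (length-filterᵇ-tabulate p (λ j → i , j))))
  where
  p : Fin n × Fin n → Bool
  p (i , j) = inverted (value ρ) i j

module _ {A : Set} {_≺_ : A → A → Set} (asym : ∀ {x y} → x ≺ y → ¬ y ≺ x) where

  strictlySorted-unique : ∀ {xs ys} → AllPairs _≺_ xs → AllPairs _≺_ ys →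
    (∀ z → z ∈ xs ⇔ z ∈ ys) → xs ≡ ys
  strictlySorted-unique {[]}     {[]}     _ _ _ = refl
  strictlySorted-unique {[]}     {y ∷ _}  _ _ xs⇔ys = contradiction (Equivalence.from (xs⇔ys y) (here refl)) λ ()
  strictlySorted-unique {x ∷ _}  {[]}     _ _ xs⇔ys = contradiction (Equivalence.to (xs⇔ys x) (here refl)) λ ()
  strictlySorted-unique {x ∷ xs} {y ∷ ys} (x≺xs ∷ xs↗) (y≺ys ∷ ys↗) xs⇔ys
    with Equivalence.to (xs⇔ys x) (here refl) | Equivalence.from (xs⇔ys y) (here refl)
  ... | here refl  | _          = cong (x ∷_) (strictlySorted-unique xs↗ ys↗ tails)
    where
    below-head : ∀ {z zs} → z ∈ x ∷ zs → x ≺ z → z ∈ zs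
    below-head (here refl)  x≺x = contradiction x≺x (λ x≺x′ → asym x≺x′ x≺x′)
    below-head (there z∈zs) _   = z∈zs
    tails : ∀ z → z ∈ xs ⇔ z ∈ ys
    tails z = mk⇔ (λ z∈xs → below-head (Equivalence.to (xs⇔ys z) (there z∈xs)) (All.lookup x≺xs z∈xs))
                  (λ z∈ys → below-head (Equivalence.from (xs⇔ys z) (there z∈ys)) (All.lookup y≺ys z∈ys))
  ... | there x∈ys | here refl  = contradiction (All.lookup y≺ys x∈ys) (λ x≺x → asym x≺x x≺x)
  ... | there x∈ys | there y∈xs = contradiction (All.lookup x≺xs y∈xs) (asym (All.lookup y≺ys x∈ys))

record Box : Set where
  constructor box
  field
    kˢ cˢ kᵗ cᵗ : ℕ
open Box

boxOf : ∀ {m} → CPair m → Box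
boxOf P = box (k₁ P) (c (S P)) (k₂ P) (c (T P))

InBox : ∀ {n} → Perm n → Box → Fin n → Set
InBox ρ B j = block (kˢ B) (toℕ j) ≡ cˢ B × block (kᵗ B) (toℕ (ρ ⟨$⟩ʳ j)) ≡ cᵗ B

HitsExactly : ∀ {n} → Perm n → Box → Fin n → Fin n → Set
HitsExactly ρ B x y = ∀ j → InBox ρ B j ⇔ (j ≡ x ⊎ j ≡ y)

∈I⇔block : ∀ {m k} {i : Fin (2 ^ m)} (I : BasicInterval m k) → i ∈I I ⇔ block k (toℕ i) ≡ c I
∈I⇔block {k = k} I = ⇔-sym (block≡⇔ k)

T-inIntervalᵇ : ∀ {m} k c (i : Fin (2 ^ m)) → Bool.T (inIntervalᵇ {m} k c i) ⇔ block k (toℕ i) ≡ c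
T-inIntervalᵇ k c i = ⇔-sym (block≡⇔ k) ⇔-∘ ((mk⇔ (≤ᵇ⇒≤ _ _) ≤⇒≤ᵇ ×-⇔ mk⇔ (<ᵇ⇒< _ _) <⇒<ᵇ) ⇔-∘ T-∧)

∈-pair⇔ : ∀ {A : Set} {z x y : A} → z ∈ x ∷ y ∷ [] ⇔ (z ≡ x ⊎ z ≡ y)
∈-pair⇔ = mk⇔ (λ { (here z≡x) → inj₁ z≡x ; (there (here z≡y)) → inj₂ z≡y })
              (λ { (inj₁ z≡x) → here z≡x ; (inj₂ z≡y) → there (here z≡y) })

hits≡pair : ∀ {m} (ρ : Perm (2 ^ m)) (Q : CPair m) {x y} → toℕ x < toℕ y → HitsExactly ρ (boxOf Q) x y →
  hits ρ Q ≡ x ∷ y ∷ []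
hits≡pair {m} ρ Q {x} {y} x<y exact = strictlySorted-unique (λ {i} {j} → <-asym {toℕ i} {toℕ j})
  (filter⁺ (T? ∘ inQ) (tabulate⁺-< id)) ((x<y All.∷ All.[]) ∷ All.[] ∷ []) members
  where
  inQ : Fin (2 ^ m) → Bool
  inQ i = inIntervalᵇ {m} (k₁ Q) (c (S Q)) i ∧ inIntervalᵇ {m} (k₂ Q) (c (T Q)) (ρ ⟨$⟩ʳ i)
  T-inQ : ∀ i → Bool.T (inQ i) ⇔ InBox ρ (boxOf Q) i
  T-inQ i = (T-inIntervalᵇ {m} (k₁ Q) (c (S Q)) i ×-⇔ T-inIntervalᵇ {m} (k₂ Q) (c (T Q)) (ρ ⟨$⟩ʳ i)) ⇔-∘ T-∧
  members : ∀ z → z ∈ hits ρ Q ⇔ z ∈ x ∷ y ∷ []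
  members z = ⇔-sym ∈-pair⇔ ⇔-∘ (exact z ⇔-∘ (T-inQ z ⇔-∘
    mk⇔ (proj₂ ∘ ∈-filter⁻ (T? ∘ inQ) {xs = allFin (2 ^ m)}) (∈-filter⁺ (T? ∘ inQ) (∈-allFin z))))

value-injective : ∀ {n} (ρ : Perm n) {x y} → value ρ x ≡ value ρ y → x ≡ y
value-injective ρ eq = Injection.injective (↔⇒↣ ρ) (toℕ-injective eq)

discordant : ∀ {n} → Perm n → Fin n → Fin n → Bool
discordant ρ x y = (toℕ x <ᵇ toℕ y) xor (value ρ x <ᵇ value ρ y)

module _ {m} (ρ : Perm (2 ^ m)) (Q : CPair m) where

  φ-of-hits : ∀ {x y} → hits ρ Q ≡ x ∷ y ∷ [] → φ ρ Q ≡ (value ρ y <ᵇ value ρ x)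
  φ-of-hits eq rewrite eq = refl

  Fl-of-hits : ∀ {x y} → hits ρ Q ≡ x ∷ y ∷ [] → Fl Q ρ ≡ transpose x y ∘ₚ ρ
  Fl-of-hits eq rewrite eq = refl

  φ≡discordant : ∀ {x y} → x ≢ y → HitsExactly ρ (boxOf Q) x y → φ ρ Q ≡ discordant ρ x y
  φ≡discordant {x} {y} x≢y exact with <-cmp (toℕ x) (toℕ y)
  ... | tri< x<y _ _ = begin
    φ ρ Q                                        ≡⟨ φ-of-hits (hits≡pair ρ Q x<y exact) ⟩
    value ρ y <ᵇ value ρ x                       ≡⟨ <ᵇ-flip (x≢y ∘ value-injective ρ) ⟩
    not (value ρ x <ᵇ value ρ y)                 ≡⟨ cong (_xor (value ρ x <ᵇ value ρ y)) (<ᵇ-true x<y) ⟨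
    discordant ρ x y                             ∎
    where open ≡-Reasoning
  ... | tri≈ _ x≡y _ = contradiction (toℕ-injective x≡y) x≢y
  ... | tri> _ _ y<x = begin
    φ ρ Q                                        ≡⟨ φ-of-hits (hits≡pair ρ Q y<x (λ j → mk⇔ Sum.swap Sum.swap ⇔-∘ exact j)) ⟩
    value ρ x <ᵇ value ρ y                       ≡⟨ cong (_xor (value ρ x <ᵇ value ρ y)) (<ᵇ-false (<⇒≯ y<x)) ⟨
    discordant ρ x y                             ∎
    where open ≡-Reasoning

χ≡true⇔ : ∀ {m} (P Q : CPair m) → χ P Q ≡ true ⇔ boxOf P ≡ boxOf Q
χ≡true⇔ P Q = box≡⇔ ⇔-∘ ((T-≡ᵇ ×-⇔ ((T-≡ᵇ ×-⇔ ((T-≡ᵇ ×-⇔ T-≡ᵇ) ⇔-∘ T-∧)) ⇔-∘ T-∧)) ⇔-∘ (T-∧ ⇔-∘ ⇔-sym T-≡))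
  where
  T-≡ᵇ : ∀ {x y} → Bool.T (x ≡ᵇ y) ⇔ x ≡ y
  T-≡ᵇ = mk⇔ (≡ᵇ⇒≡ _ _) (≡⇒≡ᵇ _ _)
  box≡⇔ : ∀ {B B′ : Box} → (kˢ B ≡ kˢ B′ × cˢ B ≡ cˢ B′ × kᵗ B ≡ kᵗ B′ × cᵗ B ≡ cᵗ B′) ⇔ B ≡ B′
  box≡⇔ {box _ _ _ _} {box _ _ _ _} =
    mk⇔ (λ { (refl , refl , refl , refl) → refl }) (λ { refl → refl , refl , refl , refl })

∈I×∈I⇔InBox : ∀ {m k₁ k₂} (ρ : Perm (2 ^ m)) (I : BasicInterval m k₁) (J : BasicInterval m k₂) {i} →
  (i ∈I I × (ρ ⟨$⟩ʳ i) ∈I J) ⇔ InBox ρ (box k₁ (c I) k₂ (c J)) i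
∈I×∈I⇔InBox ρ I J = ∈I⇔block I ×-⇔ ∈I⇔block J

-- Well-distributed permutations and their flips

module WellDistributed {m} (π : Perm (2 ^ m)) (dwd : DWD m π) where

  inBox-exists : ∀ k₁ k₂ {c₁ c₂} → k₁ + k₂ ≡ m → c₁ < 2 ^ (m ∸ k₁) → c₂ < 2 ^ (m ∸ k₂) →
    ∃[ x ] InBox π (box k₁ c₁ k₂ c₂) x
  inBox-exists k₁ k₂ k₁+k₂≡m c₁< c₂< with dwd k₁ k₂ k₁+k₂≡m (interval {k = k₁} _ c₁<) (interval {k = k₂} _ c₂<)
  ... | x , x∈ , _ =
    x , Equivalence.to (∈I×∈I⇔InBox π (interval {k = k₁} _ c₁<) (interval {k = k₂} _ c₂<)) x∈

  inBox-unique : ∀ k₁ k₂ {x y} → k₁ + k₂ ≡ m →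
    block k₁ (toℕ x) ≡ block k₁ (toℕ y) → block k₂ (value π x) ≡ block k₂ (value π y) → x ≡ y
  inBox-unique k₁ k₂ {x} {y} k₁+k₂≡m sameS sameT =
    trans (sym (unique (inBoxₓ (refl , refl)))) (unique (inBoxₓ (sym sameS , sym sameT)))
    where
    Sₓ : BasicInterval m k₁
    Sₓ = interval (block k₁ (toℕ x)) (block-< (subst (k₁ ≤_) k₁+k₂≡m (m≤m+n k₁ k₂)) (toℕ<n x))
    Tₓ : BasicInterval m k₂
    Tₓ = interval (block k₂ (value π x)) (block-< (subst (k₂ ≤_) k₁+k₂≡m (m≤n+m k₂ k₁)) (toℕ<n _))
    unique : ∀ {i} → i ∈I Sₓ × (π ⟨$⟩ʳ i) ∈I Tₓ → proj₁ (dwd k₁ k₂ k₁+k₂≡m Sₓ Tₓ) ≡ i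
    unique = proj₂ (proj₂ (dwd k₁ k₂ k₁+k₂≡m Sₓ Tₓ))
    inBoxₓ : ∀ {i} → InBox π (box k₁ (c Sₓ) k₂ (c Tₓ)) i → i ∈I Sₓ × (π ⟨$⟩ʳ i) ∈I Tₓ
    inBoxₓ = Equivalence.from (∈I×∈I⇔InBox π Sₓ Tₓ)

  complementary-hits : ∀ {k₁ k₂ c₁ c₂} → k₁ + k₂ ≡ suc m → 1 ≤ k₁ → 1 ≤ k₂ →
    c₁ < 2 ^ (m ∸ k₁) → c₂ < 2 ^ (m ∸ k₂) →
    ∃[ x ] ∃[ y ] toℕ x < toℕ y × HitsExactly π (box k₁ c₁ k₂ c₂) x y
  complementary-hits {suc k} {suc l} {c₁} {c₂} k₁+k₂≡ _ _ c₁< c₂< =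
    x , y , x<y , λ j → mk⇔ (to j) from
    where
    k+k₂≡m : k + suc l ≡ m
    k+k₂≡m = suc-injective k₁+k₂≡
    k<m : k < m
    k<m = subst (k <_) k+k₂≡m (m<m+n k z<s)
    left : ∃[ x ] InBox π (box k (c₁ * 2) (suc l) c₂) x
    left = inBox-exists k (suc l) k+k₂≡m (<-trans (n<1+n _) (children-< k<m c₁<)) c₂<
    right : ∃[ y ] InBox π (box k (suc (c₁ * 2)) (suc l) c₂) y
    right = inBox-exists k (suc l) k+k₂≡m (children-< k<m c₁<) c₂<
    x y : Fin (2 ^ m)
    x = proj₁ left
    y = proj₁ right
    x<y : toℕ x < toℕ y
    x<y = block-cancel-< k (subst₂ _<_ (sym (proj₁ (proj₂ left))) (sym (proj₁ (proj₂ right))) (n<1+n _))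
    to : ∀ j → InBox π (box (suc k) c₁ (suc l) c₂) j → j ≡ x ⊎ j ≡ y
    to j (j∈S , j∈T) with Equivalence.to (block-suc≡⇔ k) j∈S
    ... | inj₁ j∈left  = inj₁ (inBox-unique k (suc l) k+k₂≡m (trans j∈left (sym (proj₁ (proj₂ left))))
                                                 (trans j∈T (sym (proj₂ (proj₂ left)))))
    ... | inj₂ j∈right = inj₂ (inBox-unique k (suc l) k+k₂≡m (trans j∈right (sym (proj₁ (proj₂ right))))
                                                 (trans j∈T (sym (proj₂ (proj₂ right)))))
    from : ∀ {j} → j ≡ x ⊎ j ≡ y → InBox π (box (suc k) c₁ (suc l) c₂) j
    from (inj₁ refl) = Equivalence.from (block-suc≡⇔ k) (inj₁ (proj₁ (proj₂ left))) , proj₂ (proj₂ left)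
    from (inj₂ refl) = Equivalence.from (block-suc≡⇔ k) (inj₂ (proj₁ (proj₂ right))) , proj₂ (proj₂ right)

module Flip {m} (π : Perm (2 ^ m)) (dwd : DWD m π) {k l c₁ c₂ : ℕ} (k+l≡m : k + suc l ≡ m)
            {a b : Fin (2 ^ m)} (a<b : toℕ a < toℕ b)
            (exact : HitsExactly π (box (suc k) c₁ (suc l) c₂) a b) where

  open WellDistributed π dwd
  open Transposition a<b

  Bᴾ : Box
  Bᴾ = box (suc k) c₁ (suc l) c₂

  π′ : Perm (2 ^ m)
  π′ = transpose a b ∘ₚ π

  moved⇒inBoxᴾ : ∀ {g} → Moved g → InBox π Bᴾ g
  moved⇒inBoxᴾ = Equivalence.from (exact _)

  unmoved⇒∉Boxᴾ : ∀ {z} → z ≢ a → z ≢ b → ¬ InBox π Bᴾ z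
  unmoved⇒∉Boxᴾ z≢a z≢b z∈ = [ z≢a , z≢b ]′ (Equivalence.to (exact _) z∈)

  a∈Bᴾ : InBox π Bᴾ a
  a∈Bᴾ = moved⇒inBoxᴾ (inj₁ refl)

  b∈Bᴾ : InBox π Bᴾ b
  b∈Bᴾ = moved⇒inBoxᴾ (inj₂ refl)

  inS⇒value-sameSide : ∀ {z} → z ≢ a → z ≢ b → block (suc k) (toℕ z) ≡ c₁ →
    SameSide (value π a) (value π b) (value π z)
  inS⇒value-sameSide z≢a z≢b z∈S =
    block-sameSide (suc l) (proj₂ a∈Bᴾ) (proj₂ b∈Bᴾ) (λ z∈T → unmoved⇒∉Boxᴾ z≢a z≢b (z∈S , z∈T))

  inT⇒position-sameSide : ∀ {z} → z ≢ a → z ≢ b → block (suc l) (value π z) ≡ c₂ →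
    SameSide (toℕ a) (toℕ b) (toℕ z)
  inT⇒position-sameSide z≢a z≢b z∈T =
    block-sameSide (suc k) (proj₁ a∈Bᴾ) (proj₁ b∈Bᴾ) (λ z∈S → unmoved⇒∉Boxᴾ z≢a z≢b (z∈S , z∈T))

  joinedˢ : block (suc k) (toℕ a) ≡ block (suc k) (toℕ b)
  joinedˢ = trans (proj₁ a∈Bᴾ) (sym (proj₁ b∈Bᴾ))

  joinedᵗ : block (suc l) (value π a) ≡ block (suc l) (value π b)
  joinedᵗ = trans (proj₂ a∈Bᴾ) (sym (proj₂ b∈Bᴾ))

  separatedˢ : block k (toℕ a) ≢ block k (toℕ b)
  separatedˢ eq = a≢b (inBox-unique k (suc l) k+l≡m eq joinedᵗ)

  separatedᵗ : block l (value π a) ≢ block l (value π b)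
  separatedᵗ eq = a≢b (inBox-unique (suc k) l (trans (sym (+-suc k l)) k+l≡m) joinedˢ eq)

  joinedˢ⇒coarser : ∀ {k′} → block k′ (toℕ a) ≡ block k′ (toℕ b) → suc k ≤ k′
  joinedˢ⇒coarser eq = ≰⇒> (λ k′≤k → separatedˢ (block-coarsen k′≤k eq))

  joinedᵗ⇒coarser : ∀ {l′} → block l′ (value π a) ≡ block l′ (value π b) → suc l ≤ l′
  joinedᵗ⇒coarser eq = ≰⇒> (λ l′≤l → separatedᵗ (block-coarsen l′≤l eq))

  separatedˢ⇒finer : ∀ {k′} → block k′ (toℕ a) ≢ block k′ (toℕ b) → k′ ≤ k
  separatedˢ⇒finer ne = ≮⇒≥ (λ k<k′ → ne (block-coarsen k<k′ joinedˢ))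

  separatedˢ⇒joinedᵗ : ∀ {k′ l′} → m ≤ k′ + l′ →
    block k′ (toℕ a) ≢ block k′ (toℕ b) → block l′ (value π a) ≡ block l′ (value π b)
  separatedˢ⇒joinedᵗ {k′} {l′} m≤ ne = block-coarsen {suc l} {l′}
    (+-complement-≤ {k} (subst (_≤ k′ + l′) (sym k+l≡m) m≤) (separatedˢ⇒finer {k′} ne)) joinedᵗ

  inBox-flip-same : ∀ B → block (kᵗ B) (value π a) ≡ block (kᵗ B) (value π b) →
    ∀ j → InBox π′ B j ⇔ InBox π B j
  inBox-flip-same B eq j = ⇔-id _ ×-⇔ ⇔-sym (swap-resp (λ i → block (kᵗ B) (value π i) ≡ cᵗ B) (≡-resp eq) j)

  inBox-flip-swap : ∀ B → block (kˢ B) (toℕ a) ≡ block (kˢ B) (toℕ b) →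
    ∀ j → InBox π′ B j ⇔ InBox π B (swap j)
  inBox-flip-swap B eq j = swap-resp (λ i → block (kˢ B) (toℕ i) ≡ cˢ B) (≡-resp eq) j ×-⇔ ⇔-id _

  hitsExactly-flip-same : ∀ B {x y} → (∀ j → InBox π′ B j ⇔ InBox π B j) →
    HitsExactly π B x y → HitsExactly π′ B x y
  hitsExactly-flip-same B same exact′ j = exact′ j ⇔-∘ same j

  hitsExactly-flip-swap : ∀ B {x y} → (∀ j → InBox π′ B j ⇔ InBox π B (swap j)) →
    HitsExactly π B x y → HitsExactly π′ B (swap x) (swap y)
  hitsExactly-flip-swap B swapped exact′ j =
    (⇔-sym ≡swap⇔swap≡ ⊎-⇔ ⇔-sym ≡swap⇔swap≡) ⇔-∘ (exact′ (swap j) ⇔-∘ swapped j)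

  dwd-preserved : DWD m π′
  dwd-preserved k₁ k₂ k₁+k₂≡m I J with block k₁ (toℕ a) ≟ block k₁ (toℕ b)
  ... | yes joined = ∃!-transport swap swap-involutive
          (λ i → ⇔-sym (∈I×∈I⇔InBox π I J) ⇔-∘ (inBox-flip-swap B joined i ⇔-∘ ∈I×∈I⇔InBox π′ I J))
          (dwd k₁ k₂ k₁+k₂≡m I J)
    where
    B : Box
    B = box k₁ (c I) k₂ (c J)
  ... | no separated = ∃!-transport id (λ _ → refl)
          (λ i → ⇔-sym (∈I×∈I⇔InBox π I J) ⇔-∘ (inBox-flip-same B joined i ⇔-∘ ∈I×∈I⇔InBox π′ I J))
          (dwd k₁ k₂ k₁+k₂≡m I J)
    where
    B : Box
    B = box k₁ (c I) k₂ (c J)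
    joined : block k₂ (value π a) ≡ block k₂ (value π b)
    joined = separatedˢ⇒joinedᵗ {k₁} (≤-reflexive (sym k₁+k₂≡m)) separated

  levels≡ : (Q : CPair m) → k₁ Q + k₂ Q ≡ suc k + suc l
  levels≡ Q = trans (sum≡ Q) (sym (cong suc k+l≡m))

  box-determined : (Q : CPair m) → ∀ {g} → Moved g → InBox π (boxOf Q) g →
    block (k₁ Q) (toℕ a) ≡ block (k₁ Q) (toℕ b) → block (k₂ Q) (value π a) ≡ block (k₂ Q) (value π b) →
    boxOf Q ≡ Bᴾ
  box-determined Q@(cpair kˢ′ kᵗ′ _ _ _ (interval cˢ′ _) (interval cᵗ′ _)) {g} g-moved (g∈S , g∈T) jS jT =
    box-cong kˢ≡ (index≡ kˢ≡ g∈S (proj₁ g∈Bᴾ)) kᵗ≡ (index≡ kᵗ≡ g∈T (proj₂ g∈Bᴾ))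
    where
    g∈Bᴾ : InBox π Bᴾ g
    g∈Bᴾ = moved⇒inBoxᴾ g-moved
    kᵗ≡ : kᵗ′ ≡ suc l
    kᵗ≡ = ≤-antisym (+-complement-≤ {kˢ′} (≤-reflexive (levels≡ Q)) (joinedˢ⇒coarser jS)) (joinedᵗ⇒coarser jT)
    kˢ≡ : kˢ′ ≡ suc k
    kˢ≡ = +-cancelʳ-≡ kᵗ′ kˢ′ (suc k) (trans (levels≡ Q) (cong (suc k +_) (sym kᵗ≡)))
    index≡ : ∀ {u v x c c′} → u ≡ v → block u x ≡ c → block v x ≡ c′ → c ≡ c′
    index≡ refl refl refl = refl
    box-cong : ∀ {u u′ v v′ x x′ y y′} → u ≡ u′ → v ≡ v′ → x ≡ x′ → y ≡ y′ → box u v x y ≡ box u′ v′ x′ y′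
    box-cong refl refl refl refl = refl

  module _ (Q : CPair m) (Q≢P : boxOf Q ≢ Bᴾ) {x y : Fin (2 ^ m)} (x≢y : x ≢ y)
           (exactQ : HitsExactly π (boxOf Q) x y) where

    private
      Bq : Box
      Bq = boxOf Q

    unchanged-via-same : (∀ j → InBox π′ Bq j ⇔ InBox π Bq j) →
      (value π (swap x) <ᵇ value π (swap y)) ≡ (value π x <ᵇ value π y) → φ π′ Q ≡ φ π Q
    unchanged-via-same same order = begin
      φ π′ Q                 ≡⟨ φ≡discordant π′ Q x≢y (hitsExactly-flip-same Bq same exactQ) ⟩
      discordant π′ x y      ≡⟨ cong ((toℕ x <ᵇ toℕ y) xor_) order ⟩
      discordant π x y       ≡⟨ φ≡discordant π Q x≢y exactQ ⟨
      φ π Q                  ∎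
      where open ≡-Reasoning

    unchanged-via-swap : (∀ j → InBox π′ Bq j ⇔ InBox π Bq (swap j)) →
      (toℕ (swap x) <ᵇ toℕ (swap y)) ≡ (toℕ x <ᵇ toℕ y) → φ π′ Q ≡ φ π Q
    unchanged-via-swap swapped order = begin
      φ π′ Q                         ≡⟨ φ≡discordant π′ Q sx≢sy (hitsExactly-flip-swap Bq swapped exactQ) ⟩
      discordant π′ (swap x) (swap y) ≡⟨ cong₂ _xor_ order (cong₂ (λ u w → value π u <ᵇ value π w)
                                                           (swap-involutive x) (swap-involutive y)) ⟩
      discordant π x y               ≡⟨ φ≡discordant π Q x≢y exactQ ⟨
      φ π Q                          ∎
      where
      open ≡-Reasoning
      sx≢sy : swap x ≢ swap y
      sx≢sy eq = x≢y (trans (sym (swap-involutive x)) (trans (cong swap eq) (swap-involutive y)))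

    private
      hit : ∀ {z} → z ≡ x ⊎ z ≡ y → InBox π Bq z
      hit = Equivalence.from (exactQ _)

      notHit⇒≢ : ∀ {e} → ¬ InBox π Bq e → x ≢ e × y ≢ e
      notHit⇒≢ e∉ = (λ { refl → e∉ (hit (inj₁ refl)) }) , (λ { refl → e∉ (hit (inj₂ refl)) })

      m≤levels : m ≤ k₁ Q + k₂ Q
      m≤levels = ≤-trans (n≤1+n m) (≤-reflexive (sym (sum≡ Q)))

    unmoved-hits : x ≢ a → x ≢ b → y ≢ a → y ≢ b → φ π′ Q ≡ φ π Q
    unmoved-hits x≢a x≢b y≢a y≢b with block (k₁ Q) (toℕ a) ≟ block (k₁ Q) (toℕ b)
    ... | yes joined   = unchanged-via-swap (inBox-flip-swap Bq joined) (swap-unmoved-<ᵇ toℕ x≢a x≢b y≢a y≢b)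
    ... | no separated = unchanged-via-same (inBox-flip-same Bq (separatedˢ⇒joinedᵗ {k₁ Q} m≤levels separated))
                                            (swap-unmoved-<ᵇ (value π) x≢a x≢b y≢a y≢b)

    -- S(Q) separates a from b, so S(Q) ⊆ S(P) and an unmoved hit of Q lies in S(P).
    moved-hit-S-separating : ∀ {g} → Moved g → InBox π Bq g → block (k₁ Q) (toℕ (swap g)) ≢ c (S Q) →
      φ π′ Q ≡ φ π Q
    moved-hit-S-separating {g} g-moved (g∈S , _) e∉S =
      unchanged-via-same (inBox-flip-same Bq (separatedˢ⇒joinedᵗ {k₁ Q} m≤levels separated))
        (swap-preserves-<ᵇ (value π) (swap-moved g-moved) (proj₁ x,y≢e) (proj₂ x,y≢e)
          (λ {z} z-hit z≢a z≢b → inS⇒value-sameSide z≢a z≢b (z∈Sᴾ z-hit)))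
      where
      separated : block (k₁ Q) (toℕ a) ≢ block (k₁ Q) (toℕ b)
      separated = moved-separated (block (k₁ Q) ∘ toℕ) g-moved g∈S e∉S
      x,y≢e : x ≢ swap g × y ≢ swap g
      x,y≢e = notHit⇒≢ (e∉S ∘ proj₁)
      z∈Sᴾ : ∀ {z} → z ≡ x ⊎ z ≡ y → block (suc k) (toℕ z) ≡ c₁
      z∈Sᴾ z-hit = trans (block-coarsen (≤-trans (separatedˢ⇒finer {k₁ Q} separated) (n≤1+n k))
                                        (trans (proj₁ (hit z-hit)) (sym g∈S)))
                         (proj₁ (moved⇒inBoxᴾ g-moved))

    -- S(Q) contains a and b, so T(Q) ⊆ T(P) and an unmoved hit of Q has its value in T(P).
    moved-hit-T-separating : ∀ {g} → Moved g → InBox π Bq g →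
      block (k₁ Q) (toℕ (swap g)) ≡ c (S Q) → block (k₂ Q) (value π (swap g)) ≢ c (T Q) → φ π′ Q ≡ φ π Q
    moved-hit-T-separating {g} g-moved (g∈S , g∈T) e∈S e∉T =
      unchanged-via-swap (inBox-flip-swap Bq joined)
        (swap-preserves-<ᵇ toℕ (swap-moved g-moved) (proj₁ x,y≢e) (proj₂ x,y≢e)
          (λ {z} z-hit z≢a z≢b → inT⇒position-sameSide z≢a z≢b (z∈Tᴾ z-hit)))
      where
      joined : block (k₁ Q) (toℕ a) ≡ block (k₁ Q) (toℕ b)
      joined = moved-joined (block (k₁ Q) ∘ toℕ) g-moved g∈S e∈S
      x,y≢e : x ≢ swap g × y ≢ swap g
      x,y≢e = notHit⇒≢ (e∉T ∘ proj₂)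
      z∈Tᴾ : ∀ {z} → z ≡ x ⊎ z ≡ y → block (suc l) (value π z) ≡ c₂
      z∈Tᴾ z-hit = trans (block-coarsen (+-complement-≤ {k₁ Q} (≤-reflexive (levels≡ Q)) (joinedˢ⇒coarser joined))
                                        (trans (proj₂ (hit z-hit)) (sym g∈T)))
                         (proj₂ (moved⇒inBoxᴾ g-moved))

    moved-hit : ∀ {g} → Moved g → InBox π Bq g → φ π′ Q ≡ φ π Q
    moved-hit {g} g-moved g∈Q@(g∈S , g∈T)
      with block (k₁ Q) (toℕ (swap g)) ≟ c (S Q) | block (k₂ Q) (value π (swap g)) ≟ c (T Q)
    ... | no e∉S  | _       = moved-hit-S-separating g-moved g∈Q e∉S
    ... | yes e∈S | no e∉T  = moved-hit-T-separating g-moved g∈Q e∈S e∉T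
    ... | yes e∈S | yes e∈T = contradiction (box-determined Q g-moved g∈Q
      (moved-joined (block (k₁ Q) ∘ toℕ) g-moved g∈S e∈S) (moved-joined (block (k₂ Q) ∘ value π) g-moved g∈T e∈T)) Q≢P

    φ-unchanged : φ π′ Q ≡ φ π Q
    φ-unchanged with view x | view y
    ... | elsewhere x≢a x≢b | elsewhere y≢a y≢b = unmoved-hits x≢a x≢b y≢a y≢b
    ... | at-a | _    = moved-hit (inj₁ refl) (hit (inj₁ refl))
    ... | at-b | _    = moved-hit (inj₂ refl) (hit (inj₁ refl))
    ... | _    | at-a = moved-hit (inj₁ refl) (hit (inj₂ refl))
    ... | _    | at-b = moved-hit (inj₂ refl) (hit (inj₂ refl))

  φ-toggled : (Q : CPair m) → boxOf Q ≡ Bᴾ → φ π′ Q ≡ not (φ π Q)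
  φ-toggled Q Q≡P = begin
    φ π′ Q                                              ≡⟨ φ≡discordant π′ Q a≢b exact′ ⟩
    discordant π′ a b                                   ≡⟨ cong ((toℕ a <ᵇ toℕ b) xor_) swapped-order ⟩
    (toℕ a <ᵇ toℕ b) xor not (value π a <ᵇ value π b)   ≡⟨ not-distribʳ-xor (toℕ a <ᵇ toℕ b) _ ⟨
    not (discordant π a b)                              ≡⟨ cong not (φ≡discordant π Q a≢b exactQ) ⟨
    not (φ π Q)                                         ∎
    where
    open ≡-Reasoning
    exactQ : HitsExactly π (boxOf Q) a b
    exactQ = subst (λ B → HitsExactly π B a b) (sym Q≡P) exact
    exact′ : HitsExactly π′ (boxOf Q) a b
    exact′ = subst (λ B → HitsExactly π′ B a b) (sym Q≡P)
      (hitsExactly-flip-same Bᴾ (inBox-flip-same Bᴾ joinedᵗ) exact)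
    swapped-order : (value π (swap a) <ᵇ value π (swap b)) ≡ not (value π a <ᵇ value π b)
    swapped-order = trans (cong₂ (λ u w → value π u <ᵇ value π w) swap-a swap-b) (<ᵇ-flip (a≢b ∘ value-injective π))

  φ-flip : (P : CPair m) → boxOf P ≡ Bᴾ → ∀ Q → φ π′ Q ≡ (φ π Q xor χ P Q)
  φ-flip P P≡ Q with χ P Q in χ≡
  ... | true  = trans (φ-toggled Q (trans (sym (Equivalence.to (χ≡true⇔ P Q) χ≡)) P≡))
                      (sym (trans (xor-comm (φ π Q) true) (true-xor (φ π Q))))
  ... | false with WellDistributed.complementary-hits π dwd (sum≡ Q) (1≤k₁ Q) (1≤k₂ Q) (c< (S Q)) (c< (T Q))
  ...   | x , y , x<y , exactQ = trans (φ-unchanged Q Q≢P (λ x≡y → <-irrefl (cong toℕ x≡y) x<y) exactQ)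
                                        (sym (xor-identityʳ (φ π Q)))
    where
    Q≢P : boxOf Q ≢ Bᴾ
    Q≢P Q≡P = contradiction (trans (sym χ≡) (Equivalence.from (χ≡true⇔ P Q) (trans P≡ (sym Q≡P)))) λ ()

  inversions-flip : ℓ π′ + iverson (value π b <ᵇ value π a) ≡ ℓ π + iverson (value π a <ᵇ value π b)
  inversions-flip rewrite ℓ≡inversions π′ | ℓ≡inversions π = inversions-swap (value π) between⇒sameSide
    where
    between⇒sameSide : ∀ z → Between (toℕ z) → SameSide (value π a) (value π b) (value π z)
    between⇒sameSide z (a<z , z<b) =
      inS⇒value-sameSide (λ { refl → <-irrefl refl a<z }) (λ { refl → <-irrefl refl z<b }) (≤-antisym
        (subst (block (suc k) (toℕ z) ≤_) (proj₁ b∈Bᴾ) (block-mono-≤ (suc k) (<⇒≤ z<b)))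
        (subst (_≤ block (suc k) (toℕ z)) (proj₁ a∈Bᴾ) (block-mono-≤ (suc k) (<⇒≤ a<z))))

  ℓ-increases : (value π b <ᵇ value π a) ≡ false → ℓ π′ ≡ ℓ π + 1
  ℓ-increases b≮a = begin
    ℓ π′                                        ≡⟨ +-identityʳ (ℓ π′) ⟨
    ℓ π′ + iverson false                        ≡⟨ cong (λ t → ℓ π′ + iverson t) b≮a ⟨
    ℓ π′ + iverson (value π b <ᵇ value π a)     ≡⟨ inversions-flip ⟩
    ℓ π + iverson (value π a <ᵇ value π b)      ≡⟨ cong (λ t → ℓ π + iverson t) a<b′ ⟩
    ℓ π + 1                                     ∎
    where
    open ≡-Reasoning
    a<b′ : (value π a <ᵇ value π b) ≡ true
    a<b′ = trans (<ᵇ-flip (a≢b ∘ sym ∘ value-injective π)) (cong not b≮a)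

  ℓ-decreases : (value π b <ᵇ value π a) ≡ true → ℓ π′ + 1 ≡ ℓ π
  ℓ-decreases b<a = begin
    ℓ π′ + 1                                    ≡⟨ cong (λ t → ℓ π′ + iverson t) b<a ⟨
    ℓ π′ + iverson (value π b <ᵇ value π a)     ≡⟨ inversions-flip ⟩
    ℓ π + iverson (value π a <ᵇ value π b)      ≡⟨ cong (λ t → ℓ π + iverson t) a≮b ⟩
    ℓ π + 0                                     ≡⟨ +-identityʳ (ℓ π) ⟩
    ℓ π                                         ∎
    where
    open ≡-Reasoning
    a≮b : (value π a <ᵇ value π b) ≡ false
    a≮b = trans (<ᵇ-flip (a≢b ∘ sym ∘ value-injective π)) (cong not b<a)

lemma2p19 : (m : ℕ) → m ≥ 1 → (π : Perm (2 ^ m)) → DWD m π → (P : CPair m) →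
    DWD m (Fl P π)
    × ((Q : CPair m) → φ (Fl P π) Q ≡ (φ π Q xor χ P Q))
    × (φ π P ≡ false → ℓ (Fl P π) ≡ ℓ π + 1)
    × (φ π P ≡ true → ℓ (Fl P π) + 1 ≡ ℓ π)
lemma2p19 m _ π dwd P@(cpair (suc k) (suc l) levels (s≤s z≤n) (s≤s z≤n) (interval c₁ c₁<) (interval c₂ c₂<))
  with WellDistributed.complementary-hits π dwd levels (s≤s z≤n) (s≤s z≤n) c₁< c₂<
... | a , b , a<b , exact
  rewrite Fl-of-hits π P (hits≡pair π P a<b exact) | φ-of-hits π P (hits≡pair π P a<b exact) =
  dwd-preserved , φ-flip P refl , ℓ-increases , ℓ-decreases
  where open Flip π dwd (suc-injective levels) a<b exact
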